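{- Let $t$ be an infinite frieze and let $i,j\in\mathbb{Z}$ with $i\neq j$. Then for all $p,q\in\mathbb{Z}$, \[ t(p,q)=\frac{t(i,p)t(j,q)-t(i,q)t(j,p)}{t(i,j)}. \] In particular, the infinite frieze is uniquely determined by its $i$-th and $j$-th rows $(t(i,p))_{p\in\mathbb{Z}}$ and $(t(j,p))_{p\in\mathbb{Z}}$.
   Context: An infinite frieze is a map $t:\mathbb{Z}\times\mathbb{Z}\to\mathbb{Z}$ such that $t(i,i)=0$; $t(i,j)\ge 1$ if $i<j$ and $t(i,i+1)=1$; $t(i,j)=-t(j,i)$ for all $i,j$; and $t(i,j)t(i+1,j+1)-t(i,j+1)t(i+1,j)=1$ for all $i,j\in\mathbb{Z}$. -}

module Defs where

open import Data.Integer using (ℤ; _+_; _-_; _*_; -_; _≤_; _<_; 0ℤ; 1ℤ)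
open import Data.Product using (_×_)
open import Relation.Binary.PropositionalEquality using (_≡_)

record IsInfiniteFrieze (t : ℤ → ℤ → ℤ) : Set where
  field
    diag      : ∀ i → t i i ≡ 0ℤ
    positive  : ∀ i j → i < j → 1ℤ ≤ t i j
    adjacent  : ∀ i → t i (i + 1ℤ) ≡ 1ℤ
    antisym   : ∀ i j → t i j ≡ - t j i
    unimodular : ∀ i j →
      t i j * t (i + 1ℤ) (j + 1ℤ) - t i (j + 1ℤ) * t (i + 1ℤ) j ≡ 1ℤ

module Submission where

-- For two integer sequences u, v let
--   minor u v p q = u p · v q − u q · v p .
-- Such 2×2 minors satisfy the three-term Plücker relation, which is
-- exactly the identity asserted by the corollary.  So it suffices to show
-- that every frieze is the array of minors of two of its adjacent rows:
--   t p q = minor (t a) (t (a+1)) p q .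
-- Both sides are pre-friezes (all frieze axioms except positivity; for the
-- minors the unimodular rule is again Plücker), and they agree on rows a
-- and a+1.  A pre-frieze is determined by two adjacent rows when compared
-- with one having no zeros off the diagonal: the unimodular rule fixes the
-- discrete Wronskian of the next row relative to the current one, and a
-- Wronskian relative to a sequence vanishing at a single point determines
-- a sequence from three of its values.  Two-sided induction over ℤ then
-- propagates agreement through all rows.  Finally t i j ≠ 0 for i ≠ j, so
-- the identity can be divided by t i j: rows i and j determine the frieze.

open import Defs
open import Data.Integer using (ℤ; _-_; _*_; 0ℤ)
open import Data.Product using (_×_)
open import Relation.Nullary using (¬_)
open import Relation.Binary.PropositionalEquality using (_≡_)

open import Algebra.Bundles using (AbelianGroup)
open import Data.Nat using (zero; suc)
open import Data.Integer using (_+_; -_; +_; -[1+_]; 1ℤ; -1ℤ; _≟_; _≤_; +≤+)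
open import Data.Integer.Base using (≢-nonZero)
open import Data.Integer.Properties
  using (+-0-abelianGroup; +-identityʳ; +-inverseʳ; neg-injective; *-cancelˡ-≡; *-cancelʳ-≡; <-cmp)
open import Data.Integer.Tactic.RingSolver using (solve-∀)
open import Data.Product using (_,_; proj₁)
open import Function using (_∘_)
open import Relation.Nullary using (yes; no)
open import Relation.Binary.Definitions using (tri<; tri≈; tri>)
open import Relation.Binary.PropositionalEquality
  using (sym; trans; cong; cong₂; subst; module ≡-Reasoning)
open import Algebra.Properties.Group (AbelianGroup.group +-0-abelianGroup)
  using (∙-cancelˡ; ∙-cancelʳ)

ℤ-induction : (P : ℤ → Set) (a : ℤ) → P a →
  (∀ q → P q → P (q + 1ℤ)) → (∀ q → P (q + 1ℤ) → P q) → ∀ q → P q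
ℤ-induction P a base forward backward q = subst P (a+[q-a]≡q a q) (from (q - a))
  where
  a+[q-a]≡q : ∀ a q → a + (q - a) ≡ q
  a+[q-a]≡q = solve-∀
  step-up : ∀ a k → (a + k) + 1ℤ ≡ a + (1ℤ + k)
  step-up = solve-∀
  step-down : ∀ a k → (a - (1ℤ + k)) + 1ℤ ≡ a - k
  step-down = solve-∀

  above : ∀ n → P (a + + n)
  above zero    = subst P (sym (+-identityʳ a)) base
  above (suc n) = subst P (step-up a (+ n)) (forward _ (above n))

  below : ∀ n → P (a - + n)
  below zero    = subst P (sym (+-identityʳ a)) base
  below (suc n) = backward _ (subst P (sym (step-down a (+ n))) (below n))

  from : ∀ k → P (a + k)
  from (+ n)    = above n
  from -[1+ n ] = below (suc n)

cancel-nonzero : ∀ c x y → ¬ c ≡ 0ℤ → c * x ≡ c * y → x ≡ y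
cancel-nonzero c x y c≢0 = *-cancelˡ-≡ c x y {{≢-nonZero c≢0}}

wronskian : (c x : ℤ → ℤ) → ℤ → ℤ
wronskian c x q = c q * x (q + 1ℤ) - c (q + 1ℤ) * x q

wronskian-congˡ : ∀ {c c'} x → (∀ q → c q ≡ c' q) → ∀ q → wronskian c x q ≡ wronskian c' x q
wronskian-congˡ x c≗c' q = cong₂ (λ a b → a * x (q + 1ℤ) - b * x q) (c≗c' q) (c≗c' (q + 1ℤ))

wronskian-swap : ∀ c x q → wronskian c x q ≡ - wronskian x c q
wronskian-swap c x q = antisym (c q) (x (q + 1ℤ)) (c (q + 1ℤ)) (x q)
  where
  antisym : ∀ a b c d → a * b - c * d ≡ - (d * c - b * a)
  antisym = solve-∀

module SameWronskian (c x y : ℤ → ℤ) (same : ∀ q → wronskian c x q ≡ wronskian c y q) where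

  forward : ∀ q → ¬ c q ≡ 0ℤ → x q ≡ y q → x (q + 1ℤ) ≡ y (q + 1ℤ)
  forward q cq≢0 xq≡yq = cancel-nonzero (c q) _ _ cq≢0
    (∙-cancelʳ (- (c (q + 1ℤ) * y q)) _ _
      (trans (cong (λ z → c q * x (q + 1ℤ) - c (q + 1ℤ) * z) (sym xq≡yq)) (same q)))

  backward : ∀ q → ¬ c (q + 1ℤ) ≡ 0ℤ → x (q + 1ℤ) ≡ y (q + 1ℤ) → x q ≡ y q
  backward q cq+1≢0 xq+1≡yq+1 = cancel-nonzero (c (q + 1ℤ)) _ _ cq+1≢0
    (neg-injective (∙-cancelˡ (c q * y (q + 1ℤ)) _ _
      (trans (cong (λ z → c q * z - c (q + 1ℤ) * x q) (sym xq+1≡yq+1)) (same q))))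

-- Rigidity: if c vanishes at most at r + 1, then a sequence is determined
-- by its Wronskian relative to c together with its values at r, r+1, r+2.
-- (Near the zero of c the three given values replace the failing steps.)
wronskian-rigid : ∀ (c x y : ℤ → ℤ) r →
  (∀ q → ¬ r + 1ℤ ≡ q → ¬ c q ≡ 0ℤ) →
  (∀ q → wronskian c x q ≡ wronskian c y q) →
  x r ≡ y r → x (r + 1ℤ) ≡ y (r + 1ℤ) → x (r + 1ℤ + 1ℤ) ≡ y (r + 1ℤ + 1ℤ) →
  ∀ q → x q ≡ y q
wronskian-rigid c x y r c≢0 same at-r at-r+1 at-r+2 =
  ℤ-induction Agree (r + 1ℤ) at-r+1 up down
  where
  open SameWronskian c x y same
  Agree : ℤ → Set
  Agree q = x q ≡ y q

  up : ∀ q → Agree q → Agree (q + 1ℤ)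
  up q h with r + 1ℤ ≟ q
  ... | yes r+1≡q = subst (Agree ∘ (_+ 1ℤ)) r+1≡q at-r+2
  ... | no  r+1≢q = forward q (c≢0 q r+1≢q) h

  down : ∀ q → Agree (q + 1ℤ) → Agree q
  down q h with r ≟ q
  ... | yes r≡q = subst Agree r≡q at-r
  ... | no  r≢q = backward q (c≢0 (q + 1ℤ) (r≢q ∘ ∙-cancelʳ 1ℤ r q)) h

record IsPreFrieze (t : ℤ → ℤ → ℤ) : Set where
  field
    diag       : ∀ i → t i i ≡ 0ℤ
    adjacent   : ∀ i → t i (i + 1ℤ) ≡ 1ℤ
    antisym    : ∀ i j → t i j ≡ - t j i
    unimodular : ∀ i j → wronskian (t i) (t (i + 1ℤ)) j ≡ 1ℤ

  subadjacent : ∀ i → t (i + 1ℤ) i ≡ -1ℤ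
  subadjacent i = trans (antisym (i + 1ℤ) i) (cong -_ (adjacent i))

  unimodular-back : ∀ i j → wronskian (t (i + 1ℤ)) (t i) j ≡ -1ℤ
  unimodular-back i j = trans (wronskian-swap (t (i + 1ℤ)) (t i) j) (cong -_ (unimodular i j))

1≰0 : ¬ 1ℤ ≤ 0ℤ
1≰0 (+≤+ ())

Nondegenerate : (ℤ → ℤ → ℤ) → Set
Nondegenerate t = ∀ i j → ¬ i ≡ j → ¬ t i j ≡ 0ℤ

module _ {t : ℤ → ℤ → ℤ} (T : IsInfiniteFrieze t) where
  open IsInfiniteFrieze T

  frieze-isPreFrieze : IsPreFrieze t
  frieze-isPreFrieze = record
    { diag = diag ; adjacent = adjacent ; antisym = antisym ; unimodular = unimodular }

  -- Positivity above the diagonal and antisymmetry below it.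
  frieze-nondegenerate : Nondegenerate t
  frieze-nondegenerate i j i≢j tij≡0 with <-cmp i j
  ... | tri< i<j _ _ = 1≰0 (subst (1ℤ ≤_) tij≡0 (positive i j i<j))
  ... | tri≈ _ i≡j _ = i≢j i≡j
  ... | tri> _ _ j<i = 1≰0 (subst (1ℤ ≤_) (trans (antisym j i) (cong -_ tij≡0)) (positive j i j<i))

module TwoAdjacentRows {s t : ℤ → ℤ → ℤ}
  (S : IsPreFrieze s) (T : IsPreFrieze t) (t≢0 : Nondegenerate t) where
  open ≡-Reasoning
  private
    module S = IsPreFrieze S
    module T = IsPreFrieze T

  RowAgrees : ℤ → Set
  RowAgrees r = ∀ q → s r q ≡ t r q

  column : ∀ {r} → RowAgrees r → ∀ p → s p r ≡ t p r
  column {r} row p = trans (S.antisym p r) (trans (cong -_ (row p)) (sym (T.antisym p r)))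

  -- Row r + 2 has Wronskian 1 relative to row r + 1, which vanishes only
  -- at r + 1; its values at r (from row r), r + 1 and r + 2 are known.
  extend-up : ∀ r → RowAgrees r → RowAgrees (r + 1ℤ) → RowAgrees (r + 1ℤ + 1ℤ)
  extend-up r row-r row-r+1 = wronskian-rigid (t r+1) (s r+2) (t r+2) r (t≢0 r+1) same
    (column row-r r+2)
    (trans (S.subadjacent r+1) (sym (T.subadjacent r+1)))
    (trans (S.diag r+2) (sym (T.diag r+2)))
    where
    r+1 = r + 1ℤ
    r+2 = r+1 + 1ℤ
    same : ∀ q → wronskian (t r+1) (s r+2) q ≡ wronskian (t r+1) (t r+2) q
    same q = begin
      wronskian (t r+1) (s r+2) q ≡⟨ wronskian-congˡ (s r+2) (sym ∘ row-r+1) q ⟩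
      wronskian (s r+1) (s r+2) q ≡⟨ S.unimodular r+1 q ⟩
      1ℤ                          ≡⟨ sym (T.unimodular r+1 q) ⟩
      wronskian (t r+1) (t r+2) q ∎

  -- Symmetrically, row r has Wronskian −1 relative to row r + 1.
  extend-down : ∀ r → RowAgrees (r + 1ℤ) → RowAgrees (r + 1ℤ + 1ℤ) → RowAgrees r
  extend-down r row-r+1 row-r+2 = wronskian-rigid (t r+1) (s r) (t r) r (t≢0 r+1) same
    (trans (S.diag r) (sym (T.diag r)))
    (trans (S.adjacent r) (sym (T.adjacent r)))
    (column row-r+2 r)
    where
    r+1 = r + 1ℤ
    same : ∀ q → wronskian (t r+1) (s r) q ≡ wronskian (t r+1) (t r) q
    same q = begin
      wronskian (t r+1) (s r) q ≡⟨ wronskian-congˡ (s r) (sym ∘ row-r+1) q ⟩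
      wronskian (s r+1) (s r) q ≡⟨ S.unimodular-back r q ⟩
      -1ℤ                       ≡⟨ sym (T.unimodular-back r q) ⟩
      wronskian (t r+1) (t r) q ∎

  agree : ∀ a → RowAgrees a → RowAgrees (a + 1ℤ) → ∀ p q → s p q ≡ t p q
  agree a row-a row-a+1 p = proj₁ (ℤ-induction Pair a (row-a , row-a+1) up down p)
    where
    Pair : ℤ → Set
    Pair r = RowAgrees r × RowAgrees (r + 1ℤ)
    up : ∀ r → Pair r → Pair (r + 1ℤ)
    up r (row-r , row-r+1) = row-r+1 , extend-up r row-r row-r+1
    down : ∀ r → Pair (r + 1ℤ) → Pair r
    down r (row-r+1 , row-r+2) = extend-down r row-r+1 row-r+2 , row-r+1

minor : (u v : ℤ → ℤ) → ℤ → ℤ → ℤ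
minor u v p q = u p * v q - u q * v p

plücker : ∀ u v i j p q →
  minor u v p q * minor u v i j ≡ minor u v i p * minor u v j q - minor u v i q * minor u v j p
plücker u v i j p q = relation (u i) (v i) (u j) (v j) (u p) (v p) (u q) (v q)
  where
  relation : ∀ ui vi uj vj up vp uq vq →
    (up * vq - uq * vp) * (ui * vj - uj * vi)
      ≡ (ui * vp - up * vi) * (uj * vq - uq * vj) - (ui * vq - uq * vi) * (uj * vp - up * vj)
  relation = solve-∀

-- Two sequences with constant Wronskian 1 give a pre-frieze of minors;
-- its unimodular rule is the Plücker relation for p, p + 1, q, q + 1.
minor-isPreFrieze : ∀ {u v} → (∀ p → wronskian u v p ≡ 1ℤ) → IsPreFrieze (minor u v)
minor-isPreFrieze {u} {v} w≡1 = record
  { diag       = λ i → +-inverseʳ (u i * v i)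
  ; adjacent   = w≡1
  ; antisym    = λ i j → swap (u i) (v j) (u j) (v i)
  ; unimodular = λ p q → trans (sym (plücker u v p (p + 1ℤ) q (q + 1ℤ))) (cong₂ _*_ (w≡1 q) (w≡1 p))
  }
  where
  swap : ∀ a b c d → a * b - c * d ≡ - (c * d - a * b)
  swap = solve-∀

module _ {t : ℤ → ℤ → ℤ} (T : IsPreFrieze t) (t≢0 : Nondegenerate t) where
  open IsPreFrieze T
  open ≡-Reasoning

  -- A nondegenerate pre-frieze is the array of minors of any two adjacent
  -- rows, since both agree on those rows.
  pre-frieze-is-minor : ∀ a p q → minor (t a) (t (a + 1ℤ)) p q ≡ t p q
  pre-frieze-is-minor a = TwoAdjacentRows.agree (minor-isPreFrieze {t a} {t (a + 1ℤ)} (unimodular a)) T t≢0 a row-a row-a+1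
    where
    first : ∀ x y → 0ℤ * y - x * -1ℤ ≡ x
    first = solve-∀
    second : ∀ x y → 1ℤ * y - x * 0ℤ ≡ y
    second = solve-∀
    row-a : ∀ q → minor (t a) (t (a + 1ℤ)) a q ≡ t a q
    row-a q = trans (cong₂ (λ m n → m * t (a + 1ℤ) q - t a q * n) (diag a) (subadjacent a))
                    (first (t a q) (t (a + 1ℤ) q))
    row-a+1 : ∀ q → minor (t a) (t (a + 1ℤ)) (a + 1ℤ) q ≡ t (a + 1ℤ) q
    row-a+1 q = trans (cong₂ (λ m n → m * t (a + 1ℤ) q - t a q * n) (adjacent a) (diag (a + 1ℤ)))
                      (second (t a q) (t (a + 1ℤ) q))

  pre-frieze-plücker : ∀ i j p q → t p q * t i j ≡ t i p * t j q - t i q * t j p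
  pre-frieze-plücker i j p q = begin
    t p q * t i j                 ≡⟨ sym (cong₂ _*_ (m p q) (m i j)) ⟩
    μ p q * μ i j                 ≡⟨ plücker (t 0ℤ) (t 1ℤ) i j p q ⟩
    μ i p * μ j q - μ i q * μ j p ≡⟨ cong₂ _-_ (cong₂ _*_ (m i p) (m j q)) (cong₂ _*_ (m i q) (m j p)) ⟩
    t i p * t j q - t i q * t j p ∎
    where
    μ = minor (t 0ℤ) (t 1ℤ)
    m = pre-frieze-is-minor 0ℤ

-- Two nondegenerate pre-friezes agreeing on rows i ≠ j coincide: by the
-- Plücker relation both satisfy t p q · t i j = (expression in rows i, j),
-- and t i j ≠ 0 may be cancelled.
determined-by-two-rows : ∀ {s t : ℤ → ℤ → ℤ} →
  IsPreFrieze s → Nondegenerate s → IsPreFrieze t → Nondegenerate t →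
  ∀ {i j} → ¬ i ≡ j → (∀ p → s i p ≡ t i p) → (∀ p → s j p ≡ t j p) →
  ∀ p q → s p q ≡ t p q
determined-by-two-rows {s} {t} S s≢0 T t≢0 {i} {j} i≢j row-i row-j p q =
  *-cancelʳ-≡ (s p q) (t p q) (t i j) {{≢-nonZero (t≢0 i j i≢j)}} (begin
    s p q * t i j                 ≡⟨ cong (s p q *_) (sym (row-i j)) ⟩
    s p q * s i j                 ≡⟨ pre-frieze-plücker S s≢0 i j p q ⟩
    s i p * s j q - s i q * s j p ≡⟨ cong₂ _-_ (cong₂ _*_ (row-i p) (row-j q)) (cong₂ _*_ (row-i q) (row-j p)) ⟩
    t i p * t j q - t i q * t j p ≡⟨ sym (pre-frieze-plücker T t≢0 i j p q) ⟩
    t p q * t i j                 ∎)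
  where open ≡-Reasoning

corollary1p10 : (t : ℤ → ℤ → ℤ) → IsInfiniteFrieze t → (i j : ℤ) → ¬ (i ≡ j) →
    (¬ (t i j ≡ 0ℤ)
      × (∀ p q → t p q * t i j ≡ t i p * t j q - t i q * t j p))
    × (∀ (s : ℤ → ℤ → ℤ) → IsInfiniteFrieze s →
        (∀ p → s i p ≡ t i p) → (∀ p → s j p ≡ t j p) →
        ∀ p q → s p q ≡ t p q)
corollary1p10 t T i j i≢j =
  (t≢0 i j i≢j , pre-frieze-plücker (frieze-isPreFrieze T) t≢0 i j) ,
  λ s S → determined-by-two-rows (frieze-isPreFrieze S) (frieze-nondegenerate S)
                                 (frieze-isPreFrieze T) t≢0 i≢j
  where
  t≢0 : Nondegenerate t
  t≢0 = frieze-nondegenerate T
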